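{- Let $S=\{x^2-2,x^2-6\}$. Then every $f\in M_S$ is irreducible over $\mathbb{Q}$.
   Context: $M_S$ is the monoid generated by $S$ under composition (including the identity map $x$). -}

module Defs where

open import Data.Nat using (ℕ; zero; suc; _≤_)
open import Data.Integer using (+_)
open import Data.Rational using (ℚ; 0ℚ; 1ℚ; _+_; _*_; -_; _/_)
open import Data.List using (List; []; _∷_; foldr)
open import Data.Bool using (Bool; true; false)
open import Data.Product using (_×_; ∃-syntax)
open import Data.Sum using (_⊎_)
open import Relation.Binary.PropositionalEquality using (_≡_; _≢_)

-- Univariate polynomials over ℚ, as lists of coefficients in ascending order
-- ([a₀, a₁, …] represents a₀ + a₁ x + …). Trailing zeros are allowed;
-- polynomial equality is coefficientwise (_≈P_).
Poly : Set
Poly = List ℚ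

coeff : Poly → ℕ → ℚ
coeff []       _       = 0ℚ
coeff (a ∷ p)  zero    = a
coeff (a ∷ p)  (suc n) = coeff p n

_≈P_ : Poly → Poly → Set
p ≈P q = ∀ n → coeff p n ≡ coeff q n

infixl 6 _+P_
infixl 7 _*P_ _·P_

_+P_ : Poly → Poly → Poly
[]      +P q       = q
(a ∷ p) +P []      = a ∷ p
(a ∷ p) +P (b ∷ q) = (a + b) ∷ (p +P q)

_·P_ : ℚ → Poly → Poly
c ·P []      = []
c ·P (a ∷ p) = (c * a) ∷ (c ·P p)

_*P_ : Poly → Poly → Poly
[]      *P q = []
(a ∷ p) *P q = (a ·P q) +P (0ℚ ∷ (p *P q))

_∘P_ : Poly → Poly → Poly
p ∘P q = foldr (λ a acc → (a ∷ []) +P (q *P acc)) [] p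

X : Poly
X = 0ℚ ∷ 1ℚ ∷ []

x²-2 : Poly
x²-2 = (- (+ 2 / 1)) ∷ 0ℚ ∷ 1ℚ ∷ []

x²-6 : Poly
x²-6 = (- (+ 6 / 1)) ∷ 0ℚ ∷ 1ℚ ∷ []

gen : Bool → Poly
gen true  = x²-2
gen false = x²-6

-- M_S: the monoid generated by S under composition (identity = x).
-- Its elements are exactly the compositions g₁ ∘ g₂ ∘ … ∘ gₖ (k ≥ 0) of generators.
word : List Bool → Poly
word []      = X
word (b ∷ w) = gen b ∘P word w

data InMS : Poly → Set where
  inMS : (w : List Bool) → InMS (word w)

IsConstant : Poly → Set
IsConstant p = ∀ n → 1 ≤ n → coeff p n ≡ 0ℚ

NonConstant : Poly → Set
NonConstant p = ∃[ n ] (1 ≤ n × coeff p n ≢ 0ℚ)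

-- irreducible over ℚ: not a unit nor zero (i.e. nonconstant), and in every
-- factorization p = g h one factor is a unit (a nonzero constant; since p ≠ 0
-- both factors are nonzero, so "constant" suffices).
Irreducible : Poly → Set
Irreducible p = NonConstant p × (∀ g h → p ≈P (g *P h) → IsConstant g ⊎ IsConstant h)

module Submission where

-- By
-- induction each word is ≡ x^d (mod 2) for some d ≥ 1: monic, with all lower coefficients
-- even.  So a word g ∘ w with g = x² + c, c ∈ {-2, -6}, equals w² + c, whose constant term
-- w(0)² + c is 2 modulo 4: it is Eisenstein at 2.  The empty word x is linear.
-- Eisenstein's criterion is proved in the form needed over ℚ: after clearing denominators a
-- factorisation reads G·H = D·P in ℤ[x]; while p ∣ D, Gauss's lemma divides p out of one
-- factor, and once p ∤ D the usual Eisenstein argument applies.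

open import Algebra.Bundles using (CommutativeRing)
open import Data.Nat as ℕ using (ℕ; zero; suc; _≤_; _<_; _∸_; z≤n; s≤s; z<s; nonTrivial⇒n>1)
import Data.Nat.Properties as ℕₚ
open import Data.Nat.Properties
  using ( <-cmp; ≤-<-connex; <-≤-connex; ∸-monoʳ-<; ∸-monoʳ-≤; m+n∸m≡n; m+[n∸m]≡n; +-cancelˡ-<
        ; m≤m+n; m<m*n; m<m+n; m<n+m; ≤-refl; ≤-trans; <⇒≤; ≤-<-trans; <-≤-trans
        ; suc-injective; m+1+n≢0)
open import Data.Bool using (Bool; true; false)
open import Data.List using (List; []; _∷_; length)
open import Data.Product using (∃-syntax; _×_; _,_; proj₂)
open import Data.Sum as Sum using (_⊎_; inj₁; inj₂)
open import Function using (_∘_)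
open import Level using (_⊔_)
open import Relation.Binary using (tri<; tri≈; tri>)
open import Relation.Binary.PropositionalEquality
  using (_≡_; _≢_; refl; sym; trans; cong; cong₂; subst; module ≡-Reasoning)
open import Relation.Nullary using (¬_; yes; no; contradiction)
open import Relation.Nullary.Decidable using (from-no)
open import Relation.Unary using (Pred; Decidable)

open import Defs

least-counterexample : ∀ {ℓ} {P : Pred ℕ ℓ} → Decidable P → ∀ {r} → ¬ P r →
                       ∃[ a ] (a ≤ r × ¬ P a × (∀ i → i < a → P i))
least-counterexample P? ¬Pr with P? 0
... | no ¬P0 = 0 , z≤n , ¬P0 , λ _ ()
least-counterexample P? {zero}  ¬Pr | yes P0 = contradiction P0 ¬Pr
least-counterexample P? {suc r} ¬Pr | yes P0 with least-counterexample (P? ∘ suc) ¬Pr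
... | a , a≤r , ¬Pa , below =
  suc a , s≤s a≤r , ¬Pa , λ { zero _ → P0 ; (suc i) (s≤s i<a) → below i i<a }

greatest-counterexample : ∀ {ℓ} {P : Pred ℕ ℓ} → Decidable P → ∀ {L} → (∀ i → L ≤ i → P i) →
                          (∀ i → P i) ⊎ ∃[ r ] (¬ P r × (∀ i → r < i → P i))
greatest-counterexample P? {zero}  beyond = inj₁ λ i → beyond i z≤n
greatest-counterexample P? {suc L} beyond
  with greatest-counterexample (P? ∘ suc) (λ i L≤i → beyond (suc i) (s≤s L≤i))
... | inj₂ (r , ¬Pr , above) = inj₂ (suc r , ¬Pr , λ { (suc i) (s≤s r<i) → above i r<i })
... | inj₁ all-suc with P? 0
...   | yes P0 = inj₁ λ { zero → P0 ; (suc i) → all-suc i }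
...   | no ¬P0 = inj₂ (0 , ¬P0 , λ { (suc i) _ → all-suc i })

-- Cauchy products of coefficient sequences

module CauchyProduct {c ℓ} (R : CommutativeRing c ℓ) where

  open CommutativeRing R renaming (refl to ≈-refl; sym to ≈-sym; trans to ≈-trans)
  open import Algebra.Properties.CommutativeSemigroup *-commutativeSemigroup
    using (xy∙z≈xz∙y)
  open import Algebra.Properties.CommutativeSemigroup +-commutativeSemigroup
    using (x∙yz≈y∙xz)
  open import Relation.Binary.Reasoning.Setoid setoid

  infixl 7 _⊛_

  -- (g ⊛ h) m = Σ_{i ≤ m} g i * h (m ∸ i), the m-th coefficient of the product.
  _⊛_ : (ℕ → Carrier) → (ℕ → Carrier) → ℕ → Carrier
  (g ⊛ h) zero    = g 0 * h 0
  (g ⊛ h) (suc m) = g 0 * h (suc m) + ((g ∘ suc) ⊛ h) m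

  ⊛-cong : ∀ {g g′ h h′} → (∀ i → g i ≈ g′ i) → (∀ j → h j ≈ h′ j) →
           ∀ m → (g ⊛ h) m ≈ (g′ ⊛ h′) m
  ⊛-cong g≈ h≈ zero    = *-cong (g≈ 0) (h≈ 0)
  ⊛-cong g≈ h≈ (suc m) = +-cong (*-cong (g≈ 0) (h≈ (suc m))) (⊛-cong (g≈ ∘ suc) h≈ m)

  ⊛-scaleˡ : ∀ a g h m → ((λ i → g i * a) ⊛ h) m ≈ (g ⊛ h) m * a
  ⊛-scaleˡ a g h zero    = xy∙z≈xz∙y (g 0) a (h 0)
  ⊛-scaleˡ a g h (suc m) = begin
    g 0 * a * h (suc m) + ((λ i → g (suc i) * a) ⊛ h) m
      ≈⟨ +-cong (xy∙z≈xz∙y (g 0) a (h (suc m))) (⊛-scaleˡ a (g ∘ suc) h m) ⟩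
    g 0 * h (suc m) * a + ((g ∘ suc) ⊛ h) m * a
      ≈⟨ ≈-sym (distribʳ a _ _) ⟩
    (g ⊛ h) (suc m) * a ∎

  ⊛-scaleʳ : ∀ a g h m → (g ⊛ (λ j → h j * a)) m ≈ (g ⊛ h) m * a
  ⊛-scaleʳ a g h zero    = ≈-sym (*-assoc (g 0) (h 0) a)
  ⊛-scaleʳ a g h (suc m) = begin
    g 0 * (h (suc m) * a) + (g ∘ suc ⊛ (λ j → h j * a)) m
      ≈⟨ +-cong (≈-sym (*-assoc (g 0) (h (suc m)) a)) (⊛-scaleʳ a (g ∘ suc) h m) ⟩
    g 0 * h (suc m) * a + ((g ∘ suc) ⊛ h) m * a
      ≈⟨ ≈-sym (distribʳ a _ _) ⟩
    (g ⊛ h) (suc m) * a ∎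

  ⊛-zeroˡ : ∀ {g} h → (∀ i → g i ≈ 0#) → ∀ m → (g ⊛ h) m ≈ 0#
  ⊛-zeroˡ h g≈0 zero    = ≈-trans (*-congʳ (g≈0 0)) (zeroˡ (h 0))
  ⊛-zeroˡ h g≈0 (suc m) =
    ≈-trans (+-cong (≈-trans (*-congʳ (g≈0 0)) (zeroˡ _)) (⊛-zeroˡ h (g≈0 ∘ suc) m)) (+-identityˡ 0#)

  ⊛-zeroʳ : ∀ g {h} → (∀ j → h j ≈ 0#) → ∀ m → (g ⊛ h) m ≈ 0#
  ⊛-zeroʳ g h≈0 zero    = ≈-trans (*-congˡ (h≈0 0)) (zeroʳ (g 0))
  ⊛-zeroʳ g h≈0 (suc m) =
    ≈-trans (+-cong (≈-trans (*-congˡ (h≈0 (suc m))) (zeroʳ _)) (⊛-zeroʳ (g ∘ suc) h≈0 m)) (+-identityˡ 0#)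

  δ₀ : ℕ → Carrier
  δ₀ zero    = 1#
  δ₀ (suc _) = 0#

  ⊛-identityʳ : ∀ g m → (g ⊛ δ₀) m ≈ g m
  ⊛-identityʳ g zero    = *-identityʳ (g 0)
  ⊛-identityʳ g (suc m) =
    ≈-trans (+-cong (zeroʳ (g 0)) (⊛-identityʳ (g ∘ suc) m)) (+-identityˡ (g (suc m)))

  record IsIdeal {ℓ′} (I : Pred Carrier ℓ′) : Set (c ⊔ ℓ′) where
    field
      0∈        : I 0#
      +-closed  : ∀ {x y} → I x → I y → I (x + y)
      *-closedʳ : ∀ {x} y → I x → I (x * y)
      *-closedˡ : ∀ x {y} → I y → I (x * y)

  module _ {ℓ′} {I : Pred Carrier ℓ′} (ideal : IsIdeal I) where

    open IsIdeal ideal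

    ⊛-∈ : ∀ g h m → (∀ i → i ≤ m → I (g i * h (m ∸ i))) → I ((g ⊛ h) m)
    ⊛-∈ g h zero    all = all 0 z≤n
    ⊛-∈ g h (suc m) all = +-closed (all 0 z≤n) (⊛-∈ (g ∘ suc) h m (λ i i≤m → all (suc i) (s≤s i≤m)))

    ⊛-∈-except : ∀ g h {m} k → k ≤ m → (∀ i → i ≤ m → i ≢ k → I (g i * h (m ∸ i))) →
                 ∃[ e ] (I e × (g ⊛ h) m ≈ g k * h (m ∸ k) + e)
    ⊛-∈-except g h {zero}  zero    _ _ = 0# , 0∈ , ≈-sym (+-identityʳ _)
    ⊛-∈-except g h {suc m} zero    _ others =
      _ , ⊛-∈ (g ∘ suc) h m (λ i i≤m → others (suc i) (s≤s i≤m) λ ()) , ≈-refl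
    ⊛-∈-except g h {suc m} (suc k) (s≤s k≤m) others
      with ⊛-∈-except (g ∘ suc) h k k≤m (λ i i≤m i≢k → others (suc i) (s≤s i≤m) (i≢k ∘ suc-injective))
    ... | e , e∈ , eq = g 0 * h (suc m) + e , +-closed (others 0 z≤n λ ()) e∈ ,
      ≈-trans (+-congˡ eq) (x∙yz≈y∙xz (g 0 * h (suc m)) _ e)

    ⊛-∈-below : ∀ g h {a b m} → (∀ i → i < a → I (g i)) → (∀ j → j < b → I (h j)) →
                m < a ℕ.+ b → I ((g ⊛ h) m)
    ⊛-∈-below g h {a} {b} {m} g∈ h∈ m<a+b = ⊛-∈ g h m term∈
      where
      term∈ : ∀ i → i ≤ m → I (g i * h (m ∸ i))
      term∈ i i≤m with <-≤-connex i a
      ... | inj₁ i<a = *-closedʳ _ (g∈ i i<a)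
      ... | inj₂ a≤i = *-closedˡ (g i) (h∈ (m ∸ i) (≤-<-trans (∸-monoʳ-≤ m a≤i) m∸a<b))
        where
        m∸a<b : m ∸ a < b
        m∸a<b = +-cancelˡ-< a (m ∸ a) b (subst (_< a ℕ.+ b) (sym (m+[n∸m]≡n (≤-trans a≤i i≤m))) m<a+b)

    ⊛-∈-above : ∀ g h {r s m} → (∀ i → r < i → I (g i)) → (∀ j → s < j → I (h j)) →
                r ℕ.+ s < m → I ((g ⊛ h) m)
    ⊛-∈-above g h {r} {s} {m} g∈ h∈ r+s<m = ⊛-∈ g h m term∈
      where
      term∈ : ∀ i → i ≤ m → I (g i * h (m ∸ i))
      term∈ i _ with ≤-<-connex i r
      ... | inj₂ r<i = *-closedʳ _ (g∈ i r<i)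
      ... | inj₁ i≤r = *-closedˡ (g i) (h∈ (m ∸ i) (<-≤-trans s<m∸r (∸-monoʳ-≤ m i≤r)))
        where
        s<m∸r : s < m ∸ r
        s<m∸r = +-cancelˡ-< r s (m ∸ r)
          (subst (r ℕ.+ s <_) (sym (m+[n∸m]≡n (≤-trans (m≤m+n r s) (<⇒≤ r+s<m)))) r+s<m)

    ⊛-lowest : ∀ g h {a b} → (∀ i → i < a → I (g i)) → (∀ j → j < b → I (h j)) →
               ∃[ e ] (I e × (g ⊛ h) (a ℕ.+ b) ≈ g a * h b + e)
    ⊛-lowest g h {a} {b} g∈ h∈ with ⊛-∈-except g h a (m≤m+n a b) others
      where
      others : ∀ i → i ≤ a ℕ.+ b → i ≢ a → I (g i * h (a ℕ.+ b ∸ i))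
      others i i≤a+b i≢a with <-cmp i a
      ... | tri< i<a _ _ = *-closedʳ _ (g∈ i i<a)
      ... | tri≈ _ i≡a _ = contradiction i≡a i≢a
      ... | tri> _ _ a<i = *-closedˡ (g i)
        (h∈ _ (subst (a ℕ.+ b ∸ i <_) (m+n∸m≡n a b) (∸-monoʳ-< a<i i≤a+b)))
    ... | e , e∈ , eq rewrite m+n∸m≡n a b = e , e∈ , eq

    ⊛-highest : ∀ g h {r s} → (∀ i → r < i → I (g i)) → (∀ j → s < j → I (h j)) →
                ∃[ e ] (I e × (g ⊛ h) (r ℕ.+ s) ≈ g r * h s + e)
    ⊛-highest g h {r} {s} g∈ h∈ with ⊛-∈-except g h r (m≤m+n r s) others
      where
      others : ∀ i → i ≤ r ℕ.+ s → i ≢ r → I (g i * h (r ℕ.+ s ∸ i))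
      others i _ i≢r with <-cmp i r
      ... | tri< i<r _ _ = *-closedˡ (g i)
        (h∈ _ (subst (_< r ℕ.+ s ∸ i) (m+n∸m≡n r s) (∸-monoʳ-< i<r (m≤m+n r s))))
      ... | tri≈ _ i≡r _ = contradiction i≡r i≢r
      ... | tri> _ _ r<i = *-closedʳ _ (g∈ i r<i)
    ... | e , e∈ , eq rewrite m+n∸m≡n r s = e , e∈ , eq

-- Integer polynomials

open import Data.Integer as ℤ using (ℤ; +_; -_; 0ℤ; 1ℤ; _+_; _*_)
open import Data.Integer.Properties
  using ( +-*-commutativeRing; *-commutativeSemigroup; _≟_; +-identityʳ; +-injective; pos-*; abs-*
        ; *-zeroʳ; *-identityˡ; *-identityʳ; *-assoc; *-cancelʳ-≡; i*j≡0⇒i≡0∨j≡0)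
open import Algebra.Properties.CommutativeSemigroup *-commutativeSemigroup using (xy∙z≈xz∙y)
open import Data.Integer.Divisibility.Signed
  using ( _∣_; divides; quotient; _∣?_; ∣-refl; ∣-trans; ∣ᵤ⇒∣; ∣⇒∣ᵤ
        ; ∣m∣n⇒∣m+n; ∣m+n∣n⇒∣m; ∣m⇒∣m*n; ∣n⇒∣m*n; *-monoˡ-∣; *-monoʳ-∣; *-cancelʳ-∣)

open CauchyProduct +-*-commutativeRing

≡0-ideal : IsIdeal (_≡ 0ℤ)
≡0-ideal = record
  { 0∈        = refl
  ; +-closed  = λ { refl refl → refl }
  ; *-closedʳ = λ { _ refl → refl }
  ; *-closedˡ = λ { x refl → *-zeroʳ x }
  }

∣-ideal : ∀ k → IsIdeal (k ∣_)
∣-ideal k = record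
  { 0∈        = divides 0ℤ refl
  ; +-closed  = ∣m∣n⇒∣m+n
  ; *-closedʳ = ∣m⇒∣m*n
  ; *-closedˡ = ∣n⇒∣m*n
  }

Bounded : (ℕ → ℤ) → ℕ → Set
Bounded G L = ∀ i → L ≤ i → G i ≡ 0ℤ

IsConstantℤ : (ℕ → ℤ) → Set
IsConstantℤ G = ∀ i → 1 ≤ i → G i ≡ 0ℤ

Monic : (ℕ → ℤ) → ℕ → Set
Monic P n = P n ≡ 1ℤ × (∀ m → n < m → P m ≡ 0ℤ)

⊛-leading : ∀ G H {r s} → (∀ i → r < i → G i ≡ 0ℤ) → (∀ j → s < j → H j ≡ 0ℤ) →
            (G ⊛ H) (r ℕ.+ s) ≡ G r * H s
⊛-leading G H G-above H-above with ⊛-highest ≡0-ideal G H G-above H-above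
... | _ , refl , eq = trans eq (+-identityʳ _)

monic-factor-degrees : ∀ {P n D LG LH} G H → Monic P n → D ≢ 0 → Bounded G LG → Bounded H LH →
                       (∀ m → (G ⊛ H) m ≡ P m * + D) →
                       ∃[ r ] ∃[ s ] (r ℕ.+ s ≡ n × G r * H s ≡ + D
                                     × (∀ i → r < i → G i ≡ 0ℤ) × (∀ j → s < j → H j ≡ 0ℤ))
monic-factor-degrees {P} {n} {D} G H (Pn≡1 , P-above) D≢0 bG bH G⊛H≡PD =
  degrees (greatest-counterexample (λ i → G i ≟ 0ℤ) bG)
          (greatest-counterexample (λ j → H j ≟ 0ℤ) bH)
  where
  G⊛Hₙ≡D : (G ⊛ H) n ≡ + D
  G⊛Hₙ≡D = trans (G⊛H≡PD n) (trans (cong (_* + D) Pn≡1) (*-identityˡ (+ D)))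

  G⊛Hₙ≢0 : (G ⊛ H) n ≢ 0ℤ
  G⊛Hₙ≢0 eq = D≢0 (+-injective (trans (sym G⊛Hₙ≡D) eq))

  degrees : (∀ i → G i ≡ 0ℤ) ⊎ ∃[ r ] (G r ≢ 0ℤ × (∀ i → r < i → G i ≡ 0ℤ)) →
            (∀ j → H j ≡ 0ℤ) ⊎ ∃[ s ] (H s ≢ 0ℤ × (∀ j → s < j → H j ≡ 0ℤ)) →
            ∃[ r ] ∃[ s ] (r ℕ.+ s ≡ n × G r * H s ≡ + D
                          × (∀ i → r < i → G i ≡ 0ℤ) × (∀ j → s < j → H j ≡ 0ℤ))
  degrees (inj₁ G≡0) _          = contradiction (⊛-zeroˡ H G≡0 n) G⊛Hₙ≢0
  degrees (inj₂ _)   (inj₁ H≡0) = contradiction (⊛-zeroʳ G H≡0 n) G⊛Hₙ≢0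
  degrees (inj₂ (r , Gr≢0 , G-above)) (inj₂ (s , Hs≢0 , H-above)) =
    r , s , r+s≡n , trans (sym top) (subst (λ k → (G ⊛ H) k ≡ + D) (sym r+s≡n) G⊛Hₙ≡D) ,
    G-above , H-above
    where
    top : (G ⊛ H) (r ℕ.+ s) ≡ G r * H s
    top = ⊛-leading G H G-above H-above

    top≢0 : G r * H s ≢ 0ℤ
    top≢0 eq with i*j≡0⇒i≡0∨j≡0 (G r) eq
    ... | inj₁ Gr≡0 = Gr≢0 Gr≡0
    ... | inj₂ Hs≡0 = Hs≢0 Hs≡0

    r+s≡n : r ℕ.+ s ≡ n
    r+s≡n with <-cmp (r ℕ.+ s) n
    ... | tri≈ _ r+s≡n _ = r+s≡n
    ... | tri< r+s<n _ _ = contradiction (⊛-∈-above ≡0-ideal G H G-above H-above r+s<n) G⊛Hₙ≢0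
    ... | tri> _ _ n<r+s =
      contradiction (trans (sym top) (trans (G⊛H≡PD _) (cong (_* + D) (P-above _ n<r+s)))) top≢0

*-pres-∣ : ∀ {k x y} → k ∣ x → k ∣ y → k * k ∣ x * y
*-pres-∣ {k} {x} k∣x k∣y = ∣-trans (*-monoˡ-∣ k k∣x) (*-monoʳ-∣ x k∣y)

infix 4 _≡X^_mod_

_≡X^_mod_ : (ℕ → ℤ) → ℕ → ℤ → Set
P ≡X^ n mod k = Monic P n × (∀ m → m < n → k ∣ P m)

Eisenstein : ℤ → (ℕ → ℤ) → ℕ → Set
Eisenstein k P n = P ≡X^ n mod k × ¬ (k * k ∣ P 0)

⊛-≡X^ : ∀ {k P Q d e} → P ≡X^ d mod k → Q ≡X^ e mod k → P ⊛ Q ≡X^ d ℕ.+ e mod k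
⊛-≡X^ {k} {P} {Q} ((Pd≡1 , P-above) , P-low) ((Qe≡1 , Q-above) , Q-low) =
  ( trans (⊛-leading P Q P-above Q-above) (cong₂ _*_ Pd≡1 Qe≡1)
  , λ _ → ⊛-∈-above ≡0-ideal P Q P-above Q-above )
  , λ _ → ⊛-∈-below (∣-ideal k) P Q P-low Q-low

infixl 6 _+ᶜ_

_+ᶜ_ : ℤ → (ℕ → ℤ) → ℕ → ℤ
(c +ᶜ P) zero    = c + P 0
(c +ᶜ P) (suc m) = P (suc m)

+ᶜ-square-eisenstein : ∀ {k c Q d} → 1 ≤ d → Q ≡X^ d mod k → k ∣ c → ¬ (k * k ∣ c) →
                       Eisenstein k (c +ᶜ Q ⊛ Q) (d ℕ.+ d)
+ᶜ-square-eisenstein {k} {c} {Q} {suc _} _ Q≡Xᵈ k∣c k²∤c with ⊛-≡X^ Q≡Xᵈ Q≡Xᵈ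
... | (top , above) , low =
  ( (top , λ { (suc m) → above (suc m) })
  , λ { zero → ∣m∣n⇒∣m+n k∣c ∘ low 0 ; (suc m) → low (suc m) } )
  , λ k²∣c+Q₀² → k²∤c (∣m+n∣n⇒∣m k²∣c+Q₀² (*-pres-∣ k∣Q₀ k∣Q₀))
  where
  k∣Q₀ : k ∣ Q 0
  k∣Q₀ = proj₂ Q≡Xᵈ 0 (s≤s z≤n)

-- Irreducibility over ℚ with denominators cleared: for every D ≠ 0, each factorisation
-- of D·P into integer polynomials has a constant factor.
TrivialFactorisations : (ℕ → ℤ) → ℕ → Set
TrivialFactorisations P D = ∀ {LG LH} G H → Bounded G LG → Bounded H LH →
                            (∀ m → (G ⊛ H) m ≡ P m * + D) → IsConstantℤ G ⊎ IsConstantℤ H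

Irreducibleℤ : (ℕ → ℤ) → Set
Irreducibleℤ P = ∀ D → D ≢ 0 → TrivialFactorisations P D

linear-irreducible : ∀ {P} → Monic P 1 → Irreducibleℤ P
linear-irreducible P-monic D D≢0 G H bG bH G⊛H≡PD
  with monic-factor-degrees G H P-monic D≢0 bG bH G⊛H≡PD
... | zero  , _     , _     , _ , G-above , _       = inj₁ G-above
... | suc _ , zero  , _     , _ , _       , H-above = inj₂ H-above
... | suc r , suc _ , r+s≡1 , _ = contradiction (suc-injective r+s≡1) (m+1+n≢0 r)

quotients : ∀ {k : ℤ} {G : ℕ → ℤ} → (∀ i → k ∣ G i) → ℕ → ℤ
quotients k∣G i = quotient (k∣G i)

module _ {k : ℤ} {G : ℕ → ℤ} (k∣G : ∀ i → k ∣ G i) where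

  quotients-bounded : ∀ {L} .{{_ : ℤ.NonZero k}} → Bounded G L → Bounded (quotients k∣G) L
  quotients-bounded bG i L≤i = *-cancelʳ-≡ _ 0ℤ k (trans (sym (_∣_.equality (k∣G i))) (bG i L≤i))

  quotients-constant : IsConstantℤ (quotients k∣G) → IsConstantℤ G
  quotients-constant const i 1≤i = trans (_∣_.equality (k∣G i)) (cong (_* k) (const i 1≤i))

  ⊛-quotientsˡ : ∀ H m → (quotients k∣G ⊛ H) m * k ≡ (G ⊛ H) m
  ⊛-quotientsˡ H m = trans (sym (⊛-scaleˡ k (quotients k∣G) H m))
                           (⊛-cong (λ i → sym (_∣_.equality (k∣G i))) (λ _ → refl) m)

  ⊛-quotientsʳ : ∀ H m → (H ⊛ quotients k∣G) m * k ≡ (H ⊛ G) m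
  ⊛-quotientsʳ H m = trans (sym (⊛-scaleʳ k H (quotients k∣G) m))
                           (⊛-cong (λ _ → refl) (λ i → sym (_∣_.equality (k∣G i))) m)

-- Eisenstein's criterion

import Data.Nat.Divisibility as Nat
open import Data.Nat.Induction using (<-rec)
open import Data.Nat.Primality using (Prime; prime[2]; euclidsLemma; prime⇒nonZero; prime⇒nonTrivial)

module _ {p} (p-prime : Prime p) where

  private
    instance
      p≢0 : ℕ.NonZero p
      p≢0 = prime⇒nonZero p-prime

    p>1 : 1 < p
    p>1 = nonTrivial⇒n>1 p {{prime⇒nonTrivial p-prime}}

  euclidsLemmaℤ : ∀ {x y} → + p ∣ x * y → + p ∣ x ⊎ + p ∣ y
  euclidsLemmaℤ {x} {y} p∣xy
    with euclidsLemma ℤ.∣ x ∣ ℤ.∣ y ∣ p-prime (subst (p Nat.∣_) (abs-* x y) (∣⇒∣ᵤ p∣xy))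
  ... | inj₁ p∣x = inj₁ (∣ᵤ⇒∣ p∣x)
  ... | inj₂ p∣y = inj₂ (∣ᵤ⇒∣ p∣y)

  p²∣xy∧p∤y⇒p²∣x : ∀ {x y} → + p * + p ∣ x * y → ¬ + p ∣ y → + p * + p ∣ x
  p²∣xy∧p∤y⇒p²∣x {x} {y} p²∣xy p∤y
    with euclidsLemmaℤ {x} {y} (∣-trans (∣m⇒∣m*n (+ p) ∣-refl) p²∣xy)
  ... | inj₂ p∣y = contradiction p∣y p∤y
  ... | inj₁ (divides a refl)
    with euclidsLemmaℤ {a} {y}
           (*-cancelʳ-∣ (+ p) {+ p} {a * y} (subst (+ p * + p ∣_) (xy∙z≈xz∙y a (+ p) y) p²∣xy))
  ...   | inj₁ p∣a = *-monoˡ-∣ (+ p) p∣a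
  ...   | inj₂ p∣y = contradiction p∣y p∤y

  ⊛-lowest-∤ : ∀ G H {a b} → (∀ i → i < a → + p ∣ G i) → (∀ j → j < b → + p ∣ H j) →
               ¬ + p ∣ G a → ¬ + p ∣ H b → ¬ + p ∣ (G ⊛ H) (a ℕ.+ b)
  ⊛-lowest-∤ G H p∣G-below p∣H-below p∤Ga p∤Hb p∣G⊛H
    with ⊛-lowest (∣-ideal (+ p)) G H p∣G-below p∣H-below
  ... | e , p∣e , G⊛H≡GaHb+e
    with euclidsLemmaℤ (∣m+n∣n⇒∣m (subst (+ p ∣_) G⊛H≡GaHb+e p∣G⊛H) p∣e)
  ...   | inj₁ p∣Ga = p∤Ga p∣Ga
  ...   | inj₂ p∣Hb = p∤Hb p∣Hb

  least-∤ : ∀ {G : ℕ → ℤ} {r} → ¬ + p ∣ G r →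
            ∃[ a ] (a ≤ r × ¬ + p ∣ G a × (∀ i → i < a → + p ∣ G i))
  least-∤ {G} = least-counterexample (λ i → + p ∣? G i)

  gauss : ∀ {G H LG LH} → Bounded G LG → Bounded H LH → (∀ m → + p ∣ (G ⊛ H) m) →
          (∀ i → + p ∣ G i) ⊎ (∀ j → + p ∣ H j)
  gauss {G} {H} bG bH p∣G⊛H
    with greatest-counterexample (λ i → + p ∣? G i) (divisible-beyond bG)
       | greatest-counterexample (λ j → + p ∣? H j) (divisible-beyond bH)
    where
    divisible-beyond : ∀ {F L} → Bounded F L → ∀ i → L ≤ i → + p ∣ F i
    divisible-beyond bF i L≤i = subst (+ p ∣_) (sym (bF i L≤i)) (divides 0ℤ refl)
  ... | inj₁ p∣G | _        = inj₁ p∣G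
  ... | inj₂ _   | inj₁ p∣H = inj₂ p∣H
  ... | inj₂ (_ , p∤Gr , _) | inj₂ (_ , p∤Hs , _)
    with least-∤ {G} p∤Gr | least-∤ {H} p∤Hs
  ...   | a , _ , p∤Ga , p∣G-below | b , _ , p∤Hb , p∣H-below =
    contradiction (p∣G⊛H (a ℕ.+ b)) (⊛-lowest-∤ G H p∣G-below p∣H-below p∤Ga p∤Hb)

  -- Were the least index a of G or b of H with a coefficient prime to p equal to 0,
  -- coefficient a + b < N of G ⊛ H would be prime to p.
  constant-terms-divisible : ∀ G H {N r s} → (∀ m → m < N → + p ∣ (G ⊛ H) m) →
                             r < N → ¬ + p ∣ G r → s < N → ¬ + p ∣ H s → + p ∣ G 0 × + p ∣ H 0
  constant-terms-divisible G H {N} p∣G⊛H-below r<N p∤Gr s<N p∤Hs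
    with least-∤ {G} p∤Gr | least-∤ {H} p∤Hs
  ... | suc _ , _ , _ , p∣G-below | suc _ , _ , _ , p∣H-below =
    p∣G-below 0 z<s , p∣H-below 0 z<s
  ... | zero , _ , p∤G₀ , _ | b , b≤s , p∤Hb , p∣H-below =
    contradiction (p∣G⊛H-below b (≤-<-trans b≤s s<N)) (⊛-lowest-∤ G H (λ _ ()) p∣H-below p∤G₀ p∤Hb)
  ... | a , a≤r , p∤Ga , p∣G-below | zero , _ , p∤H₀ , _ =
    contradiction (p∣G⊛H-below (a ℕ.+ 0)
                    (subst (_< N) (sym (ℕₚ.+-identityʳ a)) (≤-<-trans a≤r r<N)))
                  (⊛-lowest-∤ G H p∣G-below (λ _ ()) p∤Ga p∤H₀)

  eisenstein-coprime : ∀ {P n D} → Eisenstein (+ p) P n → ¬ p Nat.∣ D → TrivialFactorisations P D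
  eisenstein-coprime {P} {n} {D} ((P-monic , p∣P-below) , p²∤P₀) p∤D G H bG bH G⊛H≡PD
    with monic-factor-degrees G H P-monic (λ { refl → p∤D (p Nat.∣0) }) bG bH G⊛H≡PD
  ... | zero  , _     , _    , _      , G-above , _       = inj₁ G-above
  ... | suc _ , zero  , _    , _      , _       , H-above = inj₂ H-above
  ... | suc r , suc s , refl , GrHs≡D , _ = contradiction p²∣P₀ p²∤P₀
    where
    p∤+D : ¬ + p ∣ + D
    p∤+D = p∤D ∘ ∣⇒∣ᵤ

    p∤Gr : ¬ + p ∣ G (suc r)
    p∤Gr p∣Gr = p∤+D (subst (+ p ∣_) GrHs≡D (∣m⇒∣m*n (H (suc s)) p∣Gr))

    p∤Hs : ¬ + p ∣ H (suc s)
    p∤Hs p∣Hs = p∤+D (subst (+ p ∣_) GrHs≡D (∣n⇒∣m*n (G (suc r)) p∣Hs))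

    p∣G⊛H-below : ∀ m → m < suc r ℕ.+ suc s → + p ∣ (G ⊛ H) m
    p∣G⊛H-below m m<n = subst (+ p ∣_) (sym (G⊛H≡PD m)) (∣m⇒∣m*n (+ D) (p∣P-below m m<n))

    p²∣P₀ : + p * + p ∣ P 0
    p²∣P₀ with constant-terms-divisible G H p∣G⊛H-below
                 (m<m+n (suc r) z<s) p∤Gr (m<n+m (suc s) z<s) p∤Hs
    ... | p∣G₀ , p∣H₀ = p²∣xy∧p∤y⇒p²∣x (subst (_ ∣_) (G⊛H≡PD 0) (*-pres-∣ p∣G₀ p∣H₀)) p∤+D

  trivial-factorisations-*p : ∀ {P q} → TrivialFactorisations P q →
                              TrivialFactorisations P (q ℕ.* p)
  trivial-factorisations-*p {P} {q} trivial G H bG bH G⊛H≡Pqp =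
    Sum.[ (λ p∣G → Sum.map₁ (quotients-constant p∣G)
                     (trivial (quotients p∣G) H (quotients-bounded p∣G bG) bH
                        λ m → *-cancelʳ-≡ _ _ (+ p) (trans (⊛-quotientsˡ p∣G H m) (G⊛H≡Pq*p m))))
        , (λ p∣H → Sum.map₂ (quotients-constant p∣H)
                     (trivial G (quotients p∣H) bG (quotients-bounded p∣H bH)
                        λ m → *-cancelʳ-≡ _ _ (+ p) (trans (⊛-quotientsʳ p∣H G m) (G⊛H≡Pq*p m))))
        ]′ (gauss bG bH p∣G⊛H)
    where
    G⊛H≡Pq*p : ∀ m → (G ⊛ H) m ≡ P m * + q * + p
    G⊛H≡Pq*p m =
      trans (G⊛H≡Pqp m) (trans (cong (P m *_) (pos-* q p)) (sym (*-assoc (P m) (+ q) (+ p))))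

    p∣G⊛H : ∀ m → + p ∣ (G ⊛ H) m
    p∣G⊛H m = subst (+ p ∣_) (sym (G⊛H≡Pq*p m)) (∣n⇒∣m*n (P m * + q) ∣-refl)

  -- Induction on D: while p ∣ D, Gauss's lemma divides p out of one of the factors.
  eisenstein-irreducible : ∀ {P n} → Eisenstein (+ p) P n → Irreducibleℤ P
  eisenstein-irreducible {P} E = <-rec (λ D → D ≢ 0 → TrivialFactorisations P D) descend
    where
    descend : ∀ D → (∀ {D′} → D′ < D → D′ ≢ 0 → TrivialFactorisations P D′) →
              D ≢ 0 → TrivialFactorisations P D
    descend D smaller D≢0 with p Nat.∣? D
    ... | no p∤D = eisenstein-coprime E p∤D
    ... | yes (Nat.divides q refl) =
      trivial-factorisations-*p {P} {q} (smaller (m<m*n q p {{ℕ.≢-nonZero q≢0}} p>1) q≢0)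
      where
      q≢0 : q ≢ 0
      q≢0 refl = D≢0 refl

-- Clearing denominators

open import Data.Rational as ℚ using (ℚ; 0ℚ; 1ℚ; ↥_; ↧_; ↧ₙ_)
open import Data.Rational.Literals using (fromℤ)
import Data.Rational.Properties as ℚₚ
import Data.Rational.Unnormalised as ℚᵘ
import Data.Rational.Unnormalised.Properties as ℚᵘₚ
open import Algebra.Properties.CommutativeSemigroup
  (CommutativeRing.*-commutativeSemigroup ℚₚ.+-*-commutativeRing)
  using () renaming (x∙yz≈y∙xz to ℚ-x∙yz≈y∙xz; xy∙z≈x∙zy to ℚ-xy∙z≈x∙zy)

module ℚ⊛ = CauchyProduct ℚₚ.+-*-commutativeRing
open ℚ⊛ using () renaming (_⊛_ to _⊛ℚ_)

ι : ℤ → ℚ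
ι = fromℤ

ι-injective : ∀ {a b} → ι a ≡ ι b → a ≡ b
ι-injective = cong ↥_

ι-+ : ∀ a b → ι (a + b) ≡ ι a ℚ.+ ι b
ι-+ a b = sym (ℚₚ.toℚᵘ-injective (ℚᵘₚ.≃-trans (ℚₚ.toℚᵘ-homo-+ (ι a) (ι b))
  (ℚᵘ.*≡* (cong (_* 1ℤ) (cong₂ _+_ (*-identityʳ a) (*-identityʳ b))))))

ι-* : ∀ a b → ι (a * b) ≡ ι a ℚ.* ι b
ι-* a b = sym (ℚₚ.toℚᵘ-injective (ℚᵘₚ.≃-trans (ℚₚ.toℚᵘ-homo-* (ι a) (ι b)) (ℚᵘ.*≡* refl)))

ι-⊛ : ∀ G H m → ι ((G ⊛ H) m) ≡ ((ι ∘ G) ⊛ℚ (ι ∘ H)) m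
ι-⊛ G H zero    = ι-* (G 0) (H 0)
ι-⊛ G H (suc m) =
  trans (ι-+ (G 0 * H (suc m)) ((G ∘ suc ⊛ H) m)) (cong₂ ℚ._+_ (ι-* (G 0) (H (suc m))) (ι-⊛ (G ∘ suc) H m))

coeff-+P : ∀ p q m → coeff (p +P q) m ≡ coeff p m ℚ.+ coeff q m
coeff-+P []      q       m       = sym (ℚₚ.+-identityˡ (coeff q m))
coeff-+P (a ∷ p) []      m       = sym (ℚₚ.+-identityʳ (coeff (a ∷ p) m))
coeff-+P (a ∷ p) (b ∷ q) zero    = refl
coeff-+P (a ∷ p) (b ∷ q) (suc m) = coeff-+P p q m

coeff-·P : ∀ c p m → coeff (c ·P p) m ≡ c ℚ.* coeff p m
coeff-·P c []      m       = sym (ℚₚ.*-zeroʳ c)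
coeff-·P c (a ∷ p) zero    = refl
coeff-·P c (a ∷ p) (suc m) = coeff-·P c p m

coeff-*P : ∀ p q m → coeff (p *P q) m ≡ (coeff p ⊛ℚ coeff q) m
coeff-*P []      q m       = sym (ℚ⊛.⊛-zeroˡ (coeff q) (λ _ → refl) m)
coeff-*P (a ∷ p) q zero    =
  trans (coeff-+P (a ·P q) (0ℚ ∷ p *P q) 0) (trans (ℚₚ.+-identityʳ _) (coeff-·P a q 0))
coeff-*P (a ∷ p) q (suc m) =
  trans (coeff-+P (a ·P q) (0ℚ ∷ p *P q) (suc m)) (cong₂ ℚ._+_ (coeff-·P a q (suc m)) (coeff-*P p q m))

coeff-∘P-∷ : ∀ a p q m → coeff ((a ∷ p) ∘P q) m ≡ coeff (a ∷ []) m ℚ.+ (coeff q ⊛ℚ coeff (p ∘P q)) m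
coeff-∘P-∷ a p q m =
  trans (coeff-+P (a ∷ []) (q *P (p ∘P q)) m) (cong (coeff (a ∷ []) m ℚ.+_) (coeff-*P q (p ∘P q) m))

coeff-X∘P : ∀ q m → coeff (X ∘P q) m ≡ coeff q m
coeff-X∘P q m = begin
  coeff (X ∘P q) m
    ≡⟨ coeff-∘P-∷ 0ℚ (1ℚ ∷ []) q m ⟩
  coeff (0ℚ ∷ []) m ℚ.+ (coeff q ⊛ℚ coeff ((1ℚ ∷ []) ∘P q)) m
    ≡⟨ cong₂ ℚ._+_ (coeff-0 m) (ℚ⊛.⊛-cong (λ _ → refl) coeff-1∘P m) ⟩
  0ℚ ℚ.+ (coeff q ⊛ℚ ℚ⊛.δ₀) m
    ≡⟨ ℚₚ.+-identityˡ _ ⟩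
  (coeff q ⊛ℚ ℚ⊛.δ₀) m
    ≡⟨ ℚ⊛.⊛-identityʳ (coeff q) m ⟩
  coeff q m ∎
  where
  open ≡-Reasoning

  coeff-0 : ∀ j → coeff (0ℚ ∷ []) j ≡ 0ℚ
  coeff-0 zero    = refl
  coeff-0 (suc _) = refl

  coeff-1∘P : ∀ j → coeff ((1ℚ ∷ []) ∘P q) j ≡ ℚ⊛.δ₀ j
  coeff-1∘P j = trans (coeff-∘P-∷ 1ℚ [] q j)
    (trans (cong (coeff (1ℚ ∷ []) j ℚ.+_) (ℚ⊛.⊛-zeroʳ (coeff q) (λ _ → refl) j)) (δ₀+0 j))
    where
    δ₀+0 : ∀ j → coeff (1ℚ ∷ []) j ℚ.+ 0ℚ ≡ ℚ⊛.δ₀ j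
    δ₀+0 zero    = refl
    δ₀+0 (suc _) = refl

ι↥≡q*ι↧ : ∀ q → ι (↥ q) ≡ q ℚ.* ι (↧ q)
ι↥≡q*ι↧ q@record{} = sym (ℚₚ.toℚᵘ-injective (ℚᵘₚ.≃-trans (ℚₚ.toℚᵘ-homo-* q (ι (↧ q)))
  (ℚᵘ.*≡* (trans (*-identityʳ _) (cong (↥ q *_) (sym (*-identityʳ (↧ q))))))))

denominator : Poly → ℕ
denominator []      = 1
denominator (a ∷ g) = ↧ₙ a ℕ.* denominator g

denominator≢0 : ∀ g → denominator g ≢ 0
denominator≢0 []      ()
denominator≢0 (a ∷ g) eq = Sum.[ (λ ()) , denominator≢0 g ]′ (ℕₚ.m*n≡0⇒m≡0∨n≡0 (↧ₙ a) eq)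

ι-denominator : ∀ a g → ι (↧ a) ℚ.* ι (+ denominator g) ≡ ι (+ denominator (a ∷ g))
ι-denominator a g = trans (sym (ι-* (↧ a) _)) (cong ι (sym (pos-* (↧ₙ a) (denominator g))))

cleared : Poly → ℕ → ℤ
cleared []      _       = 0ℤ
cleared (a ∷ g) zero    = ↥ a * + denominator g
cleared (a ∷ g) (suc i) = ↧ a * cleared g i

cleared-bounded : ∀ g → Bounded (cleared g) (length g)
cleared-bounded []      _       _         = refl
cleared-bounded (a ∷ g) (suc i) (s≤s g≤i) = trans (cong (↧ a *_) (cleared-bounded g i g≤i)) (*-zeroʳ (↧ a))

ι-cleared : ∀ g i → ι (cleared g i) ≡ coeff g i ℚ.* ι (+ denominator g)
ι-cleared []      i       = refl
ι-cleared (a ∷ g) zero    = begin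
  ι (↥ a * + denominator g)                   ≡⟨ ι-* (↥ a) _ ⟩
  ι (↥ a) ℚ.* ι (+ denominator g)             ≡⟨ cong (ℚ._* _) (ι↥≡q*ι↧ a) ⟩
  a ℚ.* ι (↧ a) ℚ.* ι (+ denominator g)       ≡⟨ ℚₚ.*-assoc a _ _ ⟩
  a ℚ.* (ι (↧ a) ℚ.* ι (+ denominator g))     ≡⟨ cong (a ℚ.*_) (ι-denominator a g) ⟩
  a ℚ.* ι (+ denominator (a ∷ g))             ∎
  where open ≡-Reasoning
ι-cleared (a ∷ g) (suc i) = begin
  ι (↧ a * cleared g i)                                 ≡⟨ ι-* (↧ a) _ ⟩
  ι (↧ a) ℚ.* ι (cleared g i)                           ≡⟨ cong (ι (↧ a) ℚ.*_) (ι-cleared g i) ⟩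
  ι (↧ a) ℚ.* (coeff g i ℚ.* ι (+ denominator g))       ≡⟨ ℚ-x∙yz≈y∙xz (ι (↧ a)) (coeff g i) _ ⟩
  coeff g i ℚ.* (ι (↧ a) ℚ.* ι (+ denominator g))       ≡⟨ cong (coeff g i ℚ.*_) (ι-denominator a g) ⟩
  coeff g i ℚ.* ι (+ denominator (a ∷ g))               ∎
  where open ≡-Reasoning

cleared≡0⇒coeff≡0 : ∀ g i → cleared g i ≡ 0ℤ → coeff g i ≡ 0ℚ
cleared≡0⇒coeff≡0 []      _    _  = refl
cleared≡0⇒coeff≡0 (a ∷ g) zero eq with i*j≡0⇒i≡0∨j≡0 (↥ a) eq
... | inj₁ ↥a≡0 = ℚₚ.↥p≡0⇒p≡0 a ↥a≡0
... | inj₂ D≡0  = contradiction (+-injective D≡0) (denominator≢0 g)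
cleared≡0⇒coeff≡0 (a ∷ g) (suc i) eq with i*j≡0⇒i≡0∨j≡0 (↧ a) eq
... | inj₁ ()
... | inj₂ eq′ = cleared≡0⇒coeff≡0 g i eq′

cleared-⊛ : ∀ {f} {P : ℕ → ℤ} g h → f ≈P (g *P h) → (∀ m → coeff f m ≡ ι (P m)) →
            ∀ m → (cleared g ⊛ cleared h) m ≡ P m * + (denominator g ℕ.* denominator h)
cleared-⊛ {f} {P} g h f≈gh f≡P m = ι-injective (begin
  ι ((cleared g ⊛ cleared h) m)
    ≡⟨ ι-⊛ (cleared g) (cleared h) m ⟩
  ((ι ∘ cleared g) ⊛ℚ (ι ∘ cleared h)) m
    ≡⟨ ℚ⊛.⊛-cong (ι-cleared g) (ι-cleared h) m ⟩
  ((λ i → coeff g i ℚ.* dg) ⊛ℚ (λ j → coeff h j ℚ.* dh)) m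
    ≡⟨ ℚ⊛.⊛-scaleˡ dg (coeff g) (λ j → coeff h j ℚ.* dh) m ⟩
  (coeff g ⊛ℚ (λ j → coeff h j ℚ.* dh)) m ℚ.* dg
    ≡⟨ cong (ℚ._* dg) (ℚ⊛.⊛-scaleʳ dh (coeff g) (coeff h) m) ⟩
  (coeff g ⊛ℚ coeff h) m ℚ.* dh ℚ.* dg
    ≡⟨ cong (λ x → x ℚ.* dh ℚ.* dg) fₘ ⟩
  ι (P m) ℚ.* dh ℚ.* dg
    ≡⟨ ℚ-xy∙z≈x∙zy (ι (P m)) dh dg ⟩
  ι (P m) ℚ.* (dg ℚ.* dh)
    ≡⟨ cong (ι (P m) ℚ.*_) (sym (ι-* (+ denominator g) (+ denominator h))) ⟩
  ι (P m) ℚ.* ι (+ denominator g * + denominator h)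
    ≡⟨ sym (ι-* (P m) (+ denominator g * + denominator h)) ⟩
  ι (P m * (+ denominator g * + denominator h))
    ≡⟨ cong (ι ∘ (P m *_)) (sym (pos-* (denominator g) (denominator h))) ⟩
  ι (P m * + (denominator g ℕ.* denominator h)) ∎)
  where
  open ≡-Reasoning
  dg dh : ℚ
  dg = ι (+ denominator g)
  dh = ι (+ denominator h)

  fₘ : (coeff g ⊛ℚ coeff h) m ≡ ι (P m)
  fₘ = trans (sym (coeff-*P g h m)) (trans (sym (f≈gh m)) (f≡P m))

irreducible-over-ℚ : ∀ {f} {P : ℕ → ℤ} {n} → (∀ m → coeff f m ≡ ι (P m)) →
                     1 ≤ n → Monic P n → Irreducibleℤ P → Irreducible f
irreducible-over-ℚ {f} {P} {n} f≡P 1≤n (Pn≡1 , _) P-irreducible = nonconstant , factors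
  where
  nonconstant : NonConstant f
  nonconstant = n , 1≤n , λ fₙ≡0 → 1≢0 (trans (sym (trans (f≡P n) (cong ι Pn≡1))) fₙ≡0)
    where
    1≢0 : ι 1ℤ ≢ 0ℚ
    1≢0 ()

  cleared-constant : ∀ g → IsConstantℤ (cleared g) → IsConstant g
  cleared-constant g const i 1≤i = cleared≡0⇒coeff≡0 g i (const i 1≤i)

  factors : ∀ g h → f ≈P (g *P h) → IsConstant g ⊎ IsConstant h
  factors g h f≈gh = Sum.map (cleared-constant g) (cleared-constant h)
    (P-irreducible _ (Sum.[ denominator≢0 g , denominator≢0 h ]′ ∘ ℕₚ.m*n≡0⇒m≡0∨n≡0 _)
      (cleared g) (cleared h) (cleared-bounded g) (cleared-bounded h) (cleared-⊛ {f} {P} g h f≈gh f≡P))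

-- The words of M_S

genConstant : Bool → ℤ
genConstant true  = - + 2
genConstant false = - + 6

gen≡const∷X : ∀ b → gen b ≡ ι (genConstant b) ∷ X
gen≡const∷X true  = refl
gen≡const∷X false = refl

2∣genConstant : ∀ b → + 2 ∣ genConstant b
2∣genConstant true  = divides (- + 1) refl
2∣genConstant false = divides (- + 3) refl

4∤genConstant : ∀ b → ¬ (+ 2 * + 2 ∣ genConstant b)
4∤genConstant true  = from-no (+ 2 * + 2 ∣? genConstant true)
4∤genConstant false = from-no (+ 2 * + 2 ∣? genConstant false)

Xℤ : ℕ → ℤ
Xℤ 1 = 1ℤ
Xℤ _ = 0ℤ

Xℤ-monic : Monic Xℤ 1
Xℤ-monic = refl , above
  where
  above : ∀ m → 1 < m → Xℤ m ≡ 0ℤ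
  above (suc zero)    (s≤s ())
  above (suc (suc _)) _ = refl

Xℤ≡X¹ : ∀ {k} → Xℤ ≡X^ 1 mod k
Xℤ≡X¹ = Xℤ-monic , λ { zero _ → divides 0ℤ refl ; (suc _) (s≤s ()) }

wordℤ : List Bool → ℕ → ℤ
wordℤ []      = Xℤ
wordℤ (b ∷ w) = genConstant b +ᶜ wordℤ w ⊛ wordℤ w

ι-+ᶜ : ∀ c P m → coeff (ι c ∷ []) m ℚ.+ ι (P m) ≡ ι ((c +ᶜ P) m)
ι-+ᶜ c P zero    = sym (ι-+ c (P 0))
ι-+ᶜ c P (suc m) = ℚₚ.+-identityˡ (ι (P (suc m)))

coeff-word : ∀ w m → coeff (word w) m ≡ ι (wordℤ w m)
coeff-word []      zero          = refl
coeff-word []      (suc zero)    = refl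
coeff-word []      (suc (suc _)) = refl
coeff-word (b ∷ w) m rewrite gen≡const∷X b = begin
  coeff ((ι c ∷ X) ∘P word w) m
    ≡⟨ coeff-∘P-∷ (ι c) X (word w) m ⟩
  coeff (ι c ∷ []) m ℚ.+ (coeff (word w) ⊛ℚ coeff (X ∘P word w)) m
    ≡⟨ cong (coeff (ι c ∷ []) m ℚ.+_) square ⟩
  coeff (ι c ∷ []) m ℚ.+ ι ((wordℤ w ⊛ wordℤ w) m)
    ≡⟨ ι-+ᶜ c (wordℤ w ⊛ wordℤ w) m ⟩
  ι (wordℤ (b ∷ w) m) ∎
  where
  open ≡-Reasoning
  c : ℤ
  c = genConstant b

  square : (coeff (word w) ⊛ℚ coeff (X ∘P word w)) m ≡ ι ((wordℤ w ⊛ wordℤ w) m)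
  square = trans (ℚ⊛.⊛-cong (coeff-word w) (λ j → trans (coeff-X∘P (word w) j) (coeff-word w j)) m)
                 (sym (ι-⊛ (wordℤ w) (wordℤ w) m))

wordℤ≡Xᵈmod2 : ∀ w → ∃[ d ] (1 ≤ d × wordℤ w ≡X^ d mod + 2)
wordℤ-eisenstein : ∀ b w → ∃[ n ] (1 ≤ n × Eisenstein (+ 2) (wordℤ (b ∷ w)) n)

wordℤ≡Xᵈmod2 []      = 1 , ≤-refl , Xℤ≡X¹
wordℤ≡Xᵈmod2 (b ∷ w) with wordℤ-eisenstein b w
... | n , 1≤n , P≡Xⁿ , _ = n , 1≤n , P≡Xⁿ

wordℤ-eisenstein b w with wordℤ≡Xᵈmod2 w
... | d , 1≤d , w≡Xᵈ = d ℕ.+ d , ≤-trans 1≤d (m≤m+n d d) ,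
  +ᶜ-square-eisenstein 1≤d w≡Xᵈ (2∣genConstant b) (4∤genConstant b)

lemma4p3 : ∀ f → InMS f → Irreducible f
lemma4p3 .(word [])      (inMS [])      =
  irreducible-over-ℚ {word []} (coeff-word []) ≤-refl Xℤ-monic (linear-irreducible Xℤ-monic)
lemma4p3 .(word (b ∷ w)) (inMS (b ∷ w)) with wordℤ-eisenstein b w
... | n , 1≤n , E@((P-monic , _) , _) =
  irreducible-over-ℚ {word (b ∷ w)} (coeff-word (b ∷ w)) 1≤n P-monic (eisenstein-irreducible prime[2] E)
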